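{- Let $\varepsilon\in\{1,-1\}$ and let $x=(x_1,x_2,x_3)\in\mathbb{Z}^3$ satisfy $\varepsilon x_1x_2\ge 0$ and $x_1\ne 0$. For each $n\ge 0$ define $u_n,v_n$ by $(u_n,v_n,x_3)^T=B^{\varepsilon n}x^T$. Then for each $n\ge 0$: (1) $|u_{n+1}|>|u_n|$; (2) $|v_{n+1}|>|v_n|$; (3) $u_n\ne 0$; (4) $\varepsilon u_nv_n\ge 0$. In particular $v_n\ne 0$ for each $n\ge 1$. Moreover, if $a$ is an integer with $|a|\le 2$, $x\in\Gamma_a$ and $|x_1|>|x_2|>|x_3|$, then $|u_n|>|v_n|>|x_3|$ for every $n\ge 0$.
   Context: For an integer $a$, $\Gamma_a$ is the set of $(x_1,x_2,x_3)\in\mathbb{Z}^3$ with $x_1^2-2x_2^2+x_3^2=a$. $B=\begin{pmatrix}3&4&0\\2&3&0\\0&0&1\end{pmatrix}$, acting on column vectors. -}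

module Defs where

open import Data.Integer using (ℤ; +_; -[1+_]; _+_; _*_; -_)
open import Data.Nat using (ℕ; zero; suc)
open import Data.Product using (_×_; _,_; proj₁; proj₂)
open import Relation.Binary.PropositionalEquality using (_≡_)

ℤ³ : Set
ℤ³ = ℤ × ℤ × ℤ

B· : ℤ³ → ℤ³
B· (x₁ , x₂ , x₃) = (+ 3 * x₁ + + 4 * x₂ , + 2 * x₁ + + 3 * x₂ , x₃)

-- its inverse B⁻¹ = [[3,-4,0],[-2,3,0],[0,0,1]] (det B = 1)
B⁻¹· : ℤ³ → ℤ³
B⁻¹· (x₁ , x₂ , x₃) = (+ 3 * x₁ + - (+ 4) * x₂ , - (+ 2) * x₁ + + 3 * x₂ , x₃)

iter : (ℤ³ → ℤ³) → ℕ → ℤ³ → ℤ³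
iter f zero x = x
iter f (suc n) x = f (iter f n x)

Bpow : ℤ → ℤ³ → ℤ³
Bpow (+ n) x = iter B· n x
Bpow -[1+ n ] x = iter B⁻¹· (suc n) x

InΓ : ℤ → ℤ³ → Set
InΓ a (x₁ , x₂ , x₃) = x₁ * x₁ - (+ 2) * (x₂ * x₂) + x₃ * x₃ ≡ a
  where open Data.Integer using (_-_)

module Submission where

-- Write ε = σ ◃ 1 for a sign σ.  The hypotheses x₁ ≠ 0 and
-- ε x₁ x₂ ≥ 0 say exactly that x = (s ◃ p , (σ * s) ◃ q , x₃) with p = |x₁| > 0,
-- q = |x₂| and s the sign of x₁.  On vectors of this sign pattern, B (for σ = +)
-- and B⁻¹ (for σ = -) act on the absolute values (p , q) by the single positive
-- recurrence  grow (p , q) = (3p + 4q , 2p + 3q)  and preserve the signs.  Hence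
-- u n = s ◃ Pₙ and v n = (σ * s) ◃ Qₙ where (Pₙ , Qₙ) is the grow-orbit of (p , q).

open import Defs
open import Data.Integer using (ℤ; +_; -_; _+_; _*_; _≤_; ∣_∣; 0ℤ; 1ℤ; -[1+_]; +≤+; sign; _◃_)
open import Data.Integer.Properties using (+◃n≡+n; -◃n≡-n; abs-◃; ◃-inverse; ◃-distrib-*; pos-+; pos-*; *-identityˡ; -1*i≡-i; ∣i∣≡0⇒i≡0)
import Data.Integer.Tactic.RingSolver as ℤ-Ring
open import Data.Nat using (ℕ; suc; zero; z≤n) renaming (_<_ to _<ℕ_; _≤_ to _≤ℕ_; _+_ to _+ℕ_; _*_ to _*ℕ_)
open import Data.Nat.Properties using (m≤m+n; m<m+n; <-≤-trans; ≤-<-trans; <-trans; ≤-refl; ≤-trans; <⇒≤; <⇒≢; n≢0⇒n>0)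
import Data.Nat.Tactic.RingSolver as ℕ-Ring
open import Data.Product using (_×_; _,_; proj₁; proj₂)
open import Data.Sign using (Sign; opposite) renaming (_*_ to _*ˢ_)
open import Data.Sign.Properties using (s*s≡+)
open import Data.Sum using (_⊎_; inj₁; inj₂)
open import Data.Empty using (⊥-elim)
open import Relation.Binary.PropositionalEquality using (_≡_; _≢_; refl; sym; trans; cong; cong₂; subst; subst₂; module ≡-Reasoning)

OrbitBehaviour : ℤ → ℤ → ℤ → ℤ → Set
OrbitBehaviour ε x₁ x₂ x₃ =
    let u : ℕ → ℤ
        u n = proj₁ (Bpow (ε * + n) (x₁ , x₂ , x₃))
        v : ℕ → ℤ
        v n = proj₁ (proj₂ (Bpow (ε * + n) (x₁ , x₂ , x₃)))
    in ((n : ℕ) → proj₂ (proj₂ (Bpow (ε * + n) (x₁ , x₂ , x₃))) ≡ x₃)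
       × ((n : ℕ) → ∣ u n ∣ <ℕ ∣ u (suc n) ∣)
       × ((n : ℕ) → ∣ v n ∣ <ℕ ∣ v (suc n) ∣)
       × ((n : ℕ) → u n ≢ 0ℤ)
       × ((n : ℕ) → 0ℤ ≤ ε * u n * v n)
       × ((n : ℕ) → 1 ≤ℕ n → v n ≢ 0ℤ)
       × ((a : ℤ) → ∣ a ∣ ≤ℕ 2 → InΓ a (x₁ , x₂ , x₃) →
           ∣ x₃ ∣ <ℕ ∣ x₂ ∣ → ∣ x₂ ∣ <ℕ ∣ x₁ ∣ →
           (n : ℕ) → ∣ x₃ ∣ <ℕ ∣ v n ∣ × ∣ v n ∣ <ℕ ∣ u n ∣)

-- The action of B on absolute values: (p , q) ↦ (3p + 4q , 2p + 3q).
grow : ℕ × ℕ → ℕ × ℕ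
grow (p , q) = (3 *ℕ p +ℕ 4 *ℕ q , 2 *ℕ p +ℕ 3 *ℕ q)

orbit : ℕ × ℕ → ℕ → ℕ × ℕ
orbit pq zero = pq
orbit pq (suc n) = grow (orbit pq n)

-- Each coordinate of grow (p , q) exceeds the old one, and the first exceeds
-- the second, by a summand containing p.
grow-fst-excess : (p q : ℕ) → 3 *ℕ p +ℕ 4 *ℕ q ≡ p +ℕ (p +ℕ (p +ℕ 4 *ℕ q))
grow-fst-excess = ℕ-Ring.solve-∀

grow-snd-excess : (p q : ℕ) → 2 *ℕ p +ℕ 3 *ℕ q ≡ q +ℕ (p +ℕ (p +ℕ 2 *ℕ q))
grow-snd-excess = ℕ-Ring.solve-∀

grow-gap : (p q : ℕ) → 3 *ℕ p +ℕ 4 *ℕ q ≡ (2 *ℕ p +ℕ 3 *ℕ q) +ℕ (p +ℕ q)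
grow-gap = ℕ-Ring.solve-∀

module _ (p q : ℕ) (p>0 : 0 <ℕ p) where

  private
    p+r>0 : (r : ℕ) → 0 <ℕ p +ℕ r
    p+r>0 r = <-≤-trans p>0 (m≤m+n p r)

  grow-fst-increasing : p <ℕ proj₁ (grow (p , q))
  grow-fst-increasing =
    subst (p <ℕ_) (sym (grow-fst-excess p q)) (m<m+n p (p+r>0 _))

  grow-snd-increasing : q <ℕ proj₂ (grow (p , q))
  grow-snd-increasing =
    subst (q <ℕ_) (sym (grow-snd-excess p q)) (m<m+n q (p+r>0 _))

  grow-snd<fst : proj₂ (grow (p , q)) <ℕ proj₁ (grow (p , q))
  grow-snd<fst =
    subst (proj₂ (grow (p , q)) <ℕ_) (sym (grow-gap p q)) (m<m+n _ (p+r>0 q))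

module _ (p q : ℕ) where

  P Q : ℕ → ℕ
  P n = proj₁ (orbit (p , q) n)
  Q n = proj₂ (orbit (p , q) n)

  module _ (p>0 : 0 <ℕ p) where

    P-positive : (n : ℕ) → 0 <ℕ P n
    P-positive zero = p>0
    P-positive (suc n) = <-trans (P-positive n) (grow-fst-increasing (P n) (Q n) (P-positive n))

    P-increasing : (n : ℕ) → P n <ℕ P (suc n)
    P-increasing n = grow-fst-increasing (P n) (Q n) (P-positive n)

    Q-increasing : (n : ℕ) → Q n <ℕ Q (suc n)
    Q-increasing n = grow-snd-increasing (P n) (Q n) (P-positive n)

    Q-bounded-below : (n : ℕ) → q ≤ℕ Q n
    Q-bounded-below zero = ≤-refl
    Q-bounded-below (suc n) = ≤-trans (Q-bounded-below n) (<⇒≤ (Q-increasing n))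

    Q<P : q <ℕ p → (n : ℕ) → Q n <ℕ P n
    Q<P q<p zero = q<p
    Q<P q<p (suc n) = grow-snd<fst (P n) (Q n) (P-positive n)

◃-as-multiple : (s : Sign) (n : ℕ) → s ◃ n ≡ (s ◃ 1) * + n
◃-as-multiple Sign.+ n = trans (+◃n≡+n n) (sym (*-identityˡ (+ n)))
◃-as-multiple Sign.- n = trans (-◃n≡-n n) (sym (-1*i≡-i (+ n)))

factor-scalar : (a b c x y : ℤ) → a * (c * x) + b * (c * y) ≡ c * (a * x + b * y)
factor-scalar = ℤ-Ring.solve-∀

◃-linear : (s : Sign) (a b p q : ℕ) →
  + a * (s ◃ p) + + b * (s ◃ q) ≡ s ◃ (a *ℕ p +ℕ b *ℕ q)
◃-linear s a b p q = begin
  + a * (s ◃ p) + + b * (s ◃ q)      ≡⟨ cong₂ (λ x y → + a * x + + b * y) (◃-as-multiple s p) (◃-as-multiple s q) ⟩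
  + a * (c * + p) + + b * (c * + q)  ≡⟨ factor-scalar (+ a) (+ b) c (+ p) (+ q) ⟩
  c * (+ a * + p + + b * + q)        ≡⟨ cong (c *_) (cong₂ _+_ (sym (pos-* a p)) (sym (pos-* b q))) ⟩
  c * (+ (a *ℕ p) + + (b *ℕ q))      ≡⟨ cong (c *_) (sym (pos-+ (a *ℕ p) (b *ℕ q))) ⟩
  c * + (a *ℕ p +ℕ b *ℕ q)           ≡⟨ sym (◃-as-multiple s _) ⟩
  s ◃ (a *ℕ p +ℕ b *ℕ q)             ∎
  where
    open ≡-Reasoning
    c : ℤ
    c = s ◃ 1

opposite-◃ : (s : Sign) (n : ℕ) → opposite s ◃ n ≡ - (s ◃ n)
opposite-◃ s zero = refl
opposite-◃ Sign.+ (suc n) = refl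
opposite-◃ Sign.- (suc n) = refl

B^ : Sign → ℤ³ → ℤ³
B^ Sign.+ = B·
B^ Sign.- = B⁻¹·

Bpow-as-iter : (σ : Sign) (n : ℕ) (y : ℤ³) → Bpow ((σ ◃ 1) * + n) y ≡ iter (B^ σ) n y
Bpow-as-iter Sign.+ n y rewrite *-identityˡ (+ n) = refl
Bpow-as-iter Sign.- n y rewrite -1*i≡-i (+ n) = Bpow-negative n
  where
    Bpow-negative : (n : ℕ) → Bpow (- + n) y ≡ iter B⁻¹· n y
    Bpow-negative zero = refl
    Bpow-negative (suc n) = refl

signed : Sign → Sign → ℕ × ℕ → ℤ → ℤ³
signed s t (p , q) z = (s ◃ p , t ◃ q , z)

-- The sign bookkeeping needed for B⁻¹, where the two coordinates have opposite signs.
B⁻¹-fst-flip : (x y : ℤ) → + 3 * x + - (+ 4) * (- y) ≡ + 3 * x + + 4 * y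
B⁻¹-fst-flip = ℤ-Ring.solve-∀

B⁻¹-snd-flip : (x y : ℤ) → - (+ 2) * x + + 3 * (- y) ≡ - (+ 2 * x + + 3 * y)
B⁻¹-snd-flip = ℤ-Ring.solve-∀

B^-grow : (σ s : Sign) (pq : ℕ × ℕ) (z : ℤ) →
  B^ σ (signed s (σ *ˢ s) pq z) ≡ signed s (σ *ˢ s) (grow pq) z
B^-grow Sign.+ s (p , q) z =
  cong₂ _,_ (◃-linear s 3 4 p q) (cong₂ _,_ (◃-linear s 2 3 p q) refl)
B^-grow Sign.- s (p , q) z = cong₂ _,_ first (cong₂ _,_ second refl)
  where
    open ≡-Reasoning
    first : + 3 * (s ◃ p) + - (+ 4) * (opposite s ◃ q) ≡ s ◃ (3 *ℕ p +ℕ 4 *ℕ q)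
    first = begin
      + 3 * (s ◃ p) + - (+ 4) * (opposite s ◃ q)  ≡⟨ cong (λ w → + 3 * (s ◃ p) + - (+ 4) * w) (opposite-◃ s q) ⟩
      + 3 * (s ◃ p) + - (+ 4) * - (s ◃ q)         ≡⟨ B⁻¹-fst-flip (s ◃ p) (s ◃ q) ⟩
      + 3 * (s ◃ p) + + 4 * (s ◃ q)               ≡⟨ ◃-linear s 3 4 p q ⟩
      s ◃ (3 *ℕ p +ℕ 4 *ℕ q)                      ∎
    second : - (+ 2) * (s ◃ p) + + 3 * (opposite s ◃ q) ≡ opposite s ◃ (2 *ℕ p +ℕ 3 *ℕ q)
    second = begin
      - (+ 2) * (s ◃ p) + + 3 * (opposite s ◃ q)  ≡⟨ cong (λ w → - (+ 2) * (s ◃ p) + + 3 * w) (opposite-◃ s q) ⟩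
      - (+ 2) * (s ◃ p) + + 3 * - (s ◃ q)         ≡⟨ B⁻¹-snd-flip (s ◃ p) (s ◃ q) ⟩
      - (+ 2 * (s ◃ p) + + 3 * (s ◃ q))           ≡⟨ cong -_ (◃-linear s 2 3 p q) ⟩
      - (s ◃ (2 *ℕ p +ℕ 3 *ℕ q))                  ≡⟨ sym (opposite-◃ s _) ⟩
      opposite s ◃ (2 *ℕ p +ℕ 3 *ℕ q)             ∎

Bpow-signed : (σ s : Sign) (pq : ℕ × ℕ) (z : ℤ) (n : ℕ) →
  Bpow ((σ ◃ 1) * + n) (signed s (σ *ˢ s) pq z) ≡ signed s (σ *ˢ s) (orbit pq n) z
Bpow-signed σ s pq z n = trans (Bpow-as-iter σ n _) (iter-signed n)
  where
    iter-signed : (n : ℕ) → iter (B^ σ) n (signed s (σ *ˢ s) pq z) ≡ signed s (σ *ˢ s) (orbit pq n) z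
    iter-signed zero = refl
    iter-signed (suc n) = trans (cong (B^ σ) (iter-signed n)) (B^-grow σ s (orbit pq n) z)

◃-nonzero : (s : Sign) {n : ℕ} → 0 <ℕ n → s ◃ n ≢ 0ℤ
◃-nonzero s {n} n>0 s◃n≡0 = <⇒≢ n>0 (sym (trans (sym (abs-◃ s n)) (cong ∣_∣ s◃n≡0)))

-- For the sign pattern (s , σ * s) the product ε u v has sign (σ * s)² = +.
pattern-product-nonneg : (σ s : Sign) (m n : ℕ) → 0ℤ ≤ (σ ◃ 1) * (s ◃ m) * ((σ *ˢ s) ◃ n)
pattern-product-nonneg σ s m n = subst (0ℤ ≤_) (sym product) (square-nonneg (σ *ˢ s) (1 *ℕ m *ℕ n))
  where
    product : (σ ◃ 1) * (s ◃ m) * ((σ *ˢ s) ◃ n) ≡ ((σ *ˢ s) *ˢ (σ *ˢ s)) ◃ (1 *ℕ m *ℕ n)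
    product = trans (cong (_* ((σ *ˢ s) ◃ n)) (sym (◃-distrib-* σ s 1 m)))
                    (sym (◃-distrib-* (σ *ˢ s) (σ *ˢ s) (1 *ℕ m) n))
    square-nonneg : (t : Sign) (k : ℕ) → 0ℤ ≤ (t *ˢ t) ◃ k
    square-nonneg t k rewrite s*s≡+ t | +◃n≡+n k = +≤+ z≤n

signed-orbit-behaviour : (σ s : Sign) (p q : ℕ) → 0 <ℕ p → (z : ℤ) →
  OrbitBehaviour (σ ◃ 1) (s ◃ p) ((σ *ˢ s) ◃ q) z
signed-orbit-behaviour σ s p q p>0 z =
  third-fixed , u-increasing , v-increasing , u≢0 , εuv≥0 , v≢0 , v-between
  where
    orbit-point : (n : ℕ) → Bpow ((σ ◃ 1) * + n) (s ◃ p , (σ *ˢ s) ◃ q , z)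
                          ≡ (s ◃ P p q n , (σ *ˢ s) ◃ Q p q n , z)
    orbit-point = Bpow-signed σ s (p , q) z

    u v : ℕ → ℤ
    u n = proj₁ (Bpow ((σ ◃ 1) * + n) (s ◃ p , (σ *ˢ s) ◃ q , z))
    v n = proj₁ (proj₂ (Bpow ((σ ◃ 1) * + n) (s ◃ p , (σ *ˢ s) ◃ q , z)))

    u≡ : (n : ℕ) → u n ≡ s ◃ P p q n
    u≡ n = cong proj₁ (orbit-point n)
    v≡ : (n : ℕ) → v n ≡ (σ *ˢ s) ◃ Q p q n
    v≡ n = cong (λ y → proj₁ (proj₂ y)) (orbit-point n)
    ∣u∣≡ : (n : ℕ) → ∣ u n ∣ ≡ P p q n
    ∣u∣≡ n = trans (cong ∣_∣ (u≡ n)) (abs-◃ s _)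
    ∣v∣≡ : (n : ℕ) → ∣ v n ∣ ≡ Q p q n
    ∣v∣≡ n = trans (cong ∣_∣ (v≡ n)) (abs-◃ (σ *ˢ s) _)

    third-fixed : (n : ℕ) → proj₂ (proj₂ (Bpow ((σ ◃ 1) * + n) (s ◃ p , (σ *ˢ s) ◃ q , z))) ≡ z
    third-fixed n = cong (λ y → proj₂ (proj₂ y)) (orbit-point n)

    u-increasing : (n : ℕ) → ∣ u n ∣ <ℕ ∣ u (suc n) ∣
    u-increasing n = subst₂ _<ℕ_ (sym (∣u∣≡ n)) (sym (∣u∣≡ (suc n))) (P-increasing p q p>0 n)

    v-increasing : (n : ℕ) → ∣ v n ∣ <ℕ ∣ v (suc n) ∣
    v-increasing n = subst₂ _<ℕ_ (sym (∣v∣≡ n)) (sym (∣v∣≡ (suc n))) (Q-increasing p q p>0 n)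

    u≢0 : (n : ℕ) → u n ≢ 0ℤ
    u≢0 n u≡0 = ◃-nonzero s (P-positive p q p>0 n) (trans (sym (u≡ n)) u≡0)

    εuv≥0 : (n : ℕ) → 0ℤ ≤ (σ ◃ 1) * u n * v n
    εuv≥0 n rewrite u≡ n | v≡ n = pattern-product-nonneg σ s (P p q n) (Q p q n)

    v≢0 : (n : ℕ) → 1 ≤ℕ n → v n ≢ 0ℤ
    v≢0 (suc n) _ v≡0 =
      ◃-nonzero (σ *ˢ s) (≤-<-trans z≤n (Q-increasing p q p>0 n)) (trans (sym (v≡ (suc n))) v≡0)

    v-between : (a : ℤ) → ∣ a ∣ ≤ℕ 2 → InΓ a (s ◃ p , (σ *ˢ s) ◃ q , z) →
      ∣ z ∣ <ℕ ∣ (σ *ˢ s) ◃ q ∣ → ∣ (σ *ˢ s) ◃ q ∣ <ℕ ∣ s ◃ p ∣ →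
      (n : ℕ) → ∣ z ∣ <ℕ ∣ v n ∣ × ∣ v n ∣ <ℕ ∣ u n ∣
    v-between _ _ _ z<q q<p n rewrite ∣u∣≡ n | ∣v∣≡ n | abs-◃ s p | abs-◃ (σ *ˢ s) q =
      <-≤-trans z<q (Q-bounded-below p q p>0 n) , Q<P p q p>0 q<p n

second-coordinate-sign : (σ : Sign) (x₁ x₂ : ℤ) → x₁ ≢ 0ℤ → 0ℤ ≤ (σ ◃ 1) * x₁ * x₂ →
  (σ *ˢ sign x₁) ◃ ∣ x₂ ∣ ≡ x₂
second-coordinate-sign σ x₁ (+ zero) _ _ = refl
second-coordinate-sign σ (+ zero) x₂ x₁≢0 _ = ⊥-elim (x₁≢0 refl)
second-coordinate-sign Sign.+ (+ suc p) (+ suc q) _ _ = refl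
second-coordinate-sign Sign.+ (+ suc p) -[1+ q ] _ ()
second-coordinate-sign Sign.+ -[1+ p ] (+ suc q) _ ()
second-coordinate-sign Sign.+ -[1+ p ] -[1+ q ] _ _ = refl
second-coordinate-sign Sign.- (+ suc p) (+ suc q) _ ()
second-coordinate-sign Sign.- (+ suc p) -[1+ q ] _ _ = refl
second-coordinate-sign Sign.- -[1+ p ] (+ suc q) _ _ = refl
second-coordinate-sign Sign.- -[1+ p ] -[1+ q ] _ ()

orbit-behaviour : (σ : Sign) (x₁ x₂ x₃ : ℤ) → 0ℤ ≤ (σ ◃ 1) * x₁ * x₂ → x₁ ≢ 0ℤ →
  OrbitBehaviour (σ ◃ 1) x₁ x₂ x₃
orbit-behaviour σ x₁ x₂ x₃ εx₁x₂≥0 x₁≢0 =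
  subst₂ (λ y₁ y₂ → OrbitBehaviour (σ ◃ 1) y₁ y₂ x₃)
    (◃-inverse x₁) (second-coordinate-sign σ x₁ x₂ x₁≢0 εx₁x₂≥0)
    (signed-orbit-behaviour σ (sign x₁) ∣ x₁ ∣ ∣ x₂ ∣ ∣x₁∣>0 x₃)
  where
    ∣x₁∣>0 : 0 <ℕ ∣ x₁ ∣
    ∣x₁∣>0 = n≢0⇒n>0 (λ ∣x₁∣≡0 → x₁≢0 (∣i∣≡0⇒i≡0 ∣x₁∣≡0))

lemma5p4 : (ε : ℤ) → (ε ≡ 1ℤ ⊎ ε ≡ - 1ℤ) →
    (x₁ x₂ x₃ : ℤ) → 0ℤ ≤ ε * x₁ * x₂ → x₁ ≢ 0ℤ →
    let u : ℕ → ℤ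
        u n = proj₁ (Bpow (ε * + n) (x₁ , x₂ , x₃))
        v : ℕ → ℤ
        v n = proj₁ (proj₂ (Bpow (ε * + n) (x₁ , x₂ , x₃)))
    in ((n : ℕ) → proj₂ (proj₂ (Bpow (ε * + n) (x₁ , x₂ , x₃))) ≡ x₃)
       × ((n : ℕ) → ∣ u n ∣ <ℕ ∣ u (suc n) ∣)
       × ((n : ℕ) → ∣ v n ∣ <ℕ ∣ v (suc n) ∣)
       × ((n : ℕ) → u n ≢ 0ℤ)
       × ((n : ℕ) → 0ℤ ≤ ε * u n * v n)
       × ((n : ℕ) → 1 ≤ℕ n → v n ≢ 0ℤ)
       × ((a : ℤ) → ∣ a ∣ ≤ℕ 2 → InΓ a (x₁ , x₂ , x₃) →
           ∣ x₃ ∣ <ℕ ∣ x₂ ∣ → ∣ x₂ ∣ <ℕ ∣ x₁ ∣ →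
           (n : ℕ) → ∣ x₃ ∣ <ℕ ∣ v n ∣ × ∣ v n ∣ <ℕ ∣ u n ∣)
lemma5p4 ε (inj₁ refl) = orbit-behaviour Sign.+
lemma5p4 ε (inj₂ refl) = orbit-behaviour Sign.-
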